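{- Let $n \ge 2$, let $s$ be a nonzero integer and $m$ an integer. Then the Diophantine equation $$ \left(\frac{1}{x_1} + \frac{1}{x_2} + \cdots + \frac{1}{x_n}\right) - \frac{s}{x_1 x_2 \cdots x_n} = m $$ has infinitely many solutions in nonzero integers $(x_1,\dots,x_n)$ if and only if one of the following holds: (i) $|m| \le n-2$ (with $s$ arbitrary); (ii) $m = n-1$ and $s = 1$; or (iii) $m = -(n-1)$ and $s = (-1)^{n-1}$. -}

module Defs where

open import Data.Nat using (ℕ; zero; suc)
open import Data.Integer as ℤ using (ℤ; +_; -[1+_]; +[1+_])
open import Data.Rational as ℚ using (ℚ; 0ℚ; _/_)
open import Data.Vec using (Vec; []; _∷_)
open import Data.Vec.Relation.Unary.All using (All)
open import Data.List using (List)
open import Data.List.Membership.Propositional using (_∈_)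
open import Data.Product using (∃; _×_)
open import Relation.Nullary using (¬_)
open import Relation.Binary.PropositionalEquality using (_≡_; _≢_)

-- The reciprocal 1/x of an integer x, as a rational number.
-- Convention: recip 0 = 0 (only ever applied to nonzero integers below).
recip : ℤ → ℚ
recip (+ zero)   = 0ℚ
recip +[1+ k ]   = (+ 1) / suc k
recip -[1+ k ]   = (ℤ.- (+ 1)) / suc k

recipSum : ∀ {n} → Vec ℤ n → ℚ
recipSum []       = 0ℚ
recipSum (x ∷ xs) = recip x ℚ.+ recipSum xs

prodℤ : ∀ {n} → Vec ℤ n → ℤ
prodℤ []       = + 1
prodℤ (x ∷ xs) = x ℤ.* prodℤ xs

IsSolution : (n : ℕ) (s m : ℤ) → Vec ℤ n → Set
IsSolution n s m xs =
  All (λ x → x ≢ + 0) xs × (recipSum xs ℚ.- (s ℚ./ 1) ℚ.* recip (prodℤ xs) ≡ (m ℚ./ 1))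

Finite : {A : Set} → (A → Set) → Set
Finite {A} P = ∃ λ (l : List A) → ∀ a → P a → a ∈ l

Infinite : {A : Set} → (A → Set) → Set
Infinite P = ¬ Finite P

module Submission where

open import Data.Nat as ℕ using (ℕ; zero; suc; _≤_; _<_; _≥_; _∸_; s≤s; z≤n)
import Data.Nat.Properties as ℕP
import Data.Nat.Tactic.RingSolver as ℕRing
open import Data.Integer as ℤ using (ℤ; +_; -[1+_]; +[1+_]; 0ℤ; 1ℤ; -1ℤ; -_; ∣_∣; _^_)
import Data.Integer.Properties as ℤP
open import Data.Integer.Tactic.RingSolver using (solve-∀)
open import Data.Rational as ℚ using (ℚ; 1ℚ; _/_; toℚᵘ)
import Data.Rational.Properties as ℚP
import Data.Rational.Solver as ℚSolver
open import Data.Rational.Unnormalised as ℚᵘ using (mkℚᵘ; *≡*) renaming (_≃_ to _≃ᵘ_)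
import Data.Rational.Unnormalised.Properties as ℚᵘP
open import Data.Vec using (Vec; []; _∷_; _++_; map; sum)
open import Data.Vec.Properties using (map-∘; map-cong; map-id)
open import Data.Vec.Relation.Unary.All as All using (All; []; _∷_)
open import Data.Vec.Relation.Unary.All.Properties using (++⁺; map⁺)
open import Data.List as List using (List)
import Data.List.Relation.Unary.All as ListAll
open import Data.List.Relation.Unary.Any using (here)
open import Data.List.Membership.Propositional using (_∈_)
open import Data.List.Membership.Propositional.Properties
  using (∈-map⁺; ∈-++⁺ˡ; ∈-++⁺ʳ; ∈-applyUpTo⁺; ∈-cartesianProductWith⁺)
open import Data.List.Extrema.Nat using (max; xs≤max)
open import Data.Empty using (⊥-elim)
open import Data.Sum using (_⊎_; inj₁; inj₂; [_,_]′)
open import Data.Product using (_×_; _,_; ∃)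
open import Function using (id; _∘_)
open import Function.Bundles using (_⇔_; mk⇔; module Equivalence)
open import Relation.Nullary using (¬_; Dec)
open import Relation.Nullary.Decidable using (_⊎-dec_; _×-dec_; decidable-stable)
open import Relation.Binary.PropositionalEquality
open import Algebra.Properties.CommutativeSemigroup ℤP.*-commutativeSemigroup using (x∙yz≈y∙xz)
open import Algebra.Properties.AbelianGroup ℤP.+-0-abelianGroup using (inverseʳ-unique)

open import Defs

-- Multiplying by x₁⋯xₙ turns the equation into  eₙ₋₁(x) − s = m·x₁⋯xₙ,  where eₙ₋₁ is the
-- (n−1)-st elementary symmetric polynomial.  An entry 1 contributes exactly 1 to the
-- left-hand side, and an entry −1 contributes −1 while changing the sign of s, so the
-- infinite families (x, s − x) for n = 2, (x, 1 − x, s + x(x − 1)) for n = 3 and (x) for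
-- n = 1, s = 1 extend to every case of the criterion.
-- Conversely let m ≥ n − 1 (negating all xᵢ reduces m ≤ −(n − 1) to this case) and strip
-- the entries ±1 off a solution.  The k remaining entries have |xᵢ| ≥ 2, so
-- 2|eₖ₋₁| ≤ k·|∏xᵢ|, which forces |∏xᵢ| ≤ 2|s| unless k ≤ 2 and m is extremal; there k = 1
-- gives s = 1, and k = 2 gives (y − 1)(z − 1) = 1 − s, so |y|, |z| ≤ |s| + 2.  Hence, unless
-- m = n − 1 and s = 1, every entry of a solution is bounded by (|s| + 2)².

fromℤ : ℤ → ℚ
fromℤ i = i / 1

toℚᵘ-fromℤ : ∀ i → toℚᵘ (fromℤ i) ≃ᵘ mkℚᵘ i 0
toℚᵘ-fromℤ i = ℚP.toℚᵘ-fromℚᵘ (mkℚᵘ i 0)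

fromℤ-≃ : ∀ {i q} → mkℚᵘ i 0 ≃ᵘ toℚᵘ q → fromℤ i ≡ q
fromℤ-≃ {i} i≃q = ℚP.toℚᵘ-injective (ℚᵘP.≃-trans (toℚᵘ-fromℤ i) i≃q)

fromℤ-homo-+ : ∀ i j → fromℤ (i ℤ.+ j) ≡ fromℤ i ℚ.+ fromℤ j
fromℤ-homo-+ i j = fromℤ-≃ (begin
  mkℚᵘ (i ℤ.+ j) 0                     ≈⟨ *≡* (expand i j) ⟩
  mkℚᵘ i 0 ℚᵘ.+ mkℚᵘ j 0               ≈⟨ ℚᵘP.+-cong (toℚᵘ-fromℤ i) (toℚᵘ-fromℤ j) ⟨
  toℚᵘ (fromℤ i) ℚᵘ.+ toℚᵘ (fromℤ j)   ≈⟨ ℚP.toℚᵘ-homo-+ (fromℤ i) (fromℤ j) ⟨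
  toℚᵘ (fromℤ i ℚ.+ fromℤ j)           ∎)
  where
  open ℚᵘP.≃-Reasoning
  expand : ∀ i j → (i ℤ.+ j) ℤ.* 1ℤ ≡ (i ℤ.* 1ℤ ℤ.+ j ℤ.* 1ℤ) ℤ.* 1ℤ
  expand = solve-∀

fromℤ-homo-* : ∀ i j → fromℤ (i ℤ.* j) ≡ fromℤ i ℚ.* fromℤ j
fromℤ-homo-* i j = fromℤ-≃ (ℚᵘP.≃-trans (ℚᵘP.≃-sym (ℚᵘP.*-cong (toℚᵘ-fromℤ i) (toℚᵘ-fromℤ j)))
                                       (ℚᵘP.≃-sym (ℚP.toℚᵘ-homo-* (fromℤ i) (fromℤ j))))

fromℤ-homo‿- : ∀ i → fromℤ (- i) ≡ ℚ.- fromℤ i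
fromℤ-homo‿- i = fromℤ-≃ (ℚᵘP.≃-trans (ℚᵘP.≃-sym (ℚᵘP.-‿cong (toℚᵘ-fromℤ i)))
                                     (ℚᵘP.≃-sym (ℚP.toℚᵘ-homo‿- (fromℤ i))))

fromℤ-homo-- : ∀ i j → fromℤ (i ℤ.- j) ≡ fromℤ i ℚ.- fromℤ j
fromℤ-homo-- i j = trans (fromℤ-homo-+ i (- j)) (cong (fromℤ i ℚ.+_) (fromℤ-homo‿- j))

fromℤ-injective : ∀ {i j} → fromℤ i ≡ fromℤ j → i ≡ j
fromℤ-injective {i} {j} eq
  with ℚᵘP.≃-trans (ℚᵘP.≃-sym (toℚᵘ-fromℤ i)) (ℚᵘP.≃-trans (ℚP.toℚᵘ-cong eq) (toℚᵘ-fromℤ j))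
... | *≡* i*1≡j*1 = trans (sym (ℤP.*-identityʳ i)) (trans i*1≡j*1 (ℤP.*-identityʳ j))

recip-*-mkℚᵘ : ∀ x → x ≢ 0ℤ → toℚᵘ (recip x) ℚᵘ.* mkℚᵘ x 0 ≃ᵘ ℚᵘ.1ℚᵘ
recip-*-mkℚᵘ (+ zero) x≢0 = ⊥-elim (x≢0 refl)
recip-*-mkℚᵘ +[1+ k ] _ =
  ℚᵘP.≃-trans (ℚᵘP.*-congʳ (ℚP.toℚᵘ-fromℚᵘ (mkℚᵘ 1ℤ k))) (ℚᵘP.*-inverseˡ (mkℚᵘ +[1+ k ] 0))
recip-*-mkℚᵘ -[1+ k ] _ =
  ℚᵘP.≃-trans (ℚᵘP.*-congʳ (ℚP.toℚᵘ-fromℚᵘ (mkℚᵘ -1ℤ k))) (ℚᵘP.*-inverseˡ (mkℚᵘ -[1+ k ] 0))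

recip-*-fromℤ : ∀ x → x ≢ 0ℤ → recip x ℚ.* fromℤ x ≡ 1ℚ
recip-*-fromℤ x x≢0 = ℚP.toℚᵘ-injective (ℚᵘP.≃-trans (ℚP.toℚᵘ-homo-* (recip x) (fromℤ x))
  (ℚᵘP.≃-trans (ℚᵘP.*-congˡ {toℚᵘ (recip x)} (toℚᵘ-fromℤ x)) (recip-*-mkℚᵘ x x≢0)))

*-cancelʳ-by-inverse : ∀ {a r} x y → r ℚ.* a ≡ 1ℚ → x ℚ.* a ≡ y ℚ.* a → x ≡ y
*-cancelʳ-by-inverse {a} {r} x y r*a≡1 x*a≡y*a = begin
  x                  ≡⟨ ℚP.*-identityʳ x ⟨
  x ℚ.* 1ℚ           ≡⟨ cong (x ℚ.*_) (trans (sym r*a≡1) (ℚP.*-comm r a)) ⟩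
  x ℚ.* (a ℚ.* r)    ≡⟨ ℚP.*-assoc x a r ⟨
  (x ℚ.* a) ℚ.* r    ≡⟨ cong (ℚ._* r) x*a≡y*a ⟩
  (y ℚ.* a) ℚ.* r    ≡⟨ ℚP.*-assoc y a r ⟩
  y ℚ.* (a ℚ.* r)    ≡⟨ cong (y ℚ.*_) (trans (ℚP.*-comm a r) r*a≡1) ⟩
  y ℚ.* 1ℚ           ≡⟨ ℚP.*-identityʳ y ⟩
  y                  ∎
  where open ≡-Reasoning

-- Clearing denominators

eₙ₋₁ : ∀ {n} → Vec ℤ n → ℤ
eₙ₋₁ []       = 0ℤ
eₙ₋₁ (x ∷ xs) = prodℤ xs ℤ.+ x ℤ.* eₙ₋₁ xs

NonZeros : ∀ {n} → Vec ℤ n → Set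
NonZeros = All (_≢ 0ℤ)

defect : ∀ {n} → ℤ → ℤ → Vec ℤ n → ℤ
defect s m xs = eₙ₋₁ xs ℤ.- s ℤ.- m ℤ.* prodℤ xs

IsSolutionℤ : ∀ {n} → ℤ → ℤ → Vec ℤ n → Set
IsSolutionℤ s m xs = NonZeros xs × defect s m xs ≡ 0ℤ

prodℤ≢0 : ∀ {n} {xs : Vec ℤ n} → NonZeros xs → prodℤ xs ≢ 0ℤ
prodℤ≢0 []                          ()
prodℤ≢0 {xs = x ∷ _} (x≢0 ∷ xs≢0) xP≡0 = [ x≢0 , prodℤ≢0 xs≢0 ]′ (ℤP.i*j≡0⇒i≡0∨j≡0 x xP≡0)

recipSum-*-prodℤ : ∀ {n} {xs : Vec ℤ n} → NonZeros xs →
                   recipSum xs ℚ.* fromℤ (prodℤ xs) ≡ fromℤ (eₙ₋₁ xs)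
recipSum-*-prodℤ [] = refl
recipSum-*-prodℤ {xs = x ∷ xs} (x≢0 ∷ xs≢0) = begin
  (recip x ℚ.+ R) ℚ.* fromℤ (x ℤ.* P)                    ≡⟨ cong ((recip x ℚ.+ R) ℚ.*_) (fromℤ-homo-* x P) ⟩
  (recip x ℚ.+ R) ℚ.* (fromℤ x ℚ.* fromℤ P)              ≡⟨ expand (recip x) R (fromℤ x) (fromℤ P) ⟩
  (recip x ℚ.* fromℤ x) ℚ.* fromℤ P ℚ.+ fromℤ x ℚ.* (R ℚ.* fromℤ P)
    ≡⟨ cong₂ (λ a b → a ℚ.* fromℤ P ℚ.+ fromℤ x ℚ.* b) (recip-*-fromℤ x x≢0) (recipSum-*-prodℤ xs≢0) ⟩
  1ℚ ℚ.* fromℤ P ℚ.+ fromℤ x ℚ.* fromℤ (eₙ₋₁ xs)         ≡⟨ cong₂ ℚ._+_ (ℚP.*-identityˡ (fromℤ P)) (sym (fromℤ-homo-* x (eₙ₋₁ xs))) ⟩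
  fromℤ P ℚ.+ fromℤ (x ℤ.* eₙ₋₁ xs)                     ≡⟨ fromℤ-homo-+ P (x ℤ.* eₙ₋₁ xs) ⟨
  fromℤ (eₙ₋₁ (x ∷ xs))                                 ∎
  where
  open ≡-Reasoning
  R = recipSum xs
  P = prodℤ xs
  expand : ∀ r R X P → (r ℚ.+ R) ℚ.* (X ℚ.* P) ≡ (r ℚ.* X) ℚ.* P ℚ.+ X ℚ.* (R ℚ.* P)
  expand = solve 4 (λ r R X P → (r :+ R) :* (X :* P) := (r :* X) :* P :+ X :* (R :* P)) refl
    where open ℚSolver.+-*-Solver

IsSolution⇔IsSolutionℤ : ∀ {n} s m (xs : Vec ℤ n) → IsSolution n s m xs ⇔ IsSolutionℤ s m xs
IsSolution⇔IsSolutionℤ s m xs = mk⇔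
  (λ (xs≢0 , lhs≡m) → xs≢0 , ℤP.i≡j⇒i-j≡0 (fromℤ-injective {eₙ₋₁ xs ℤ.- s} {m ℤ.* P} (begin
     fromℤ (eₙ₋₁ xs ℤ.- s)   ≡⟨ lhs-*-prodℤ xs≢0 ⟨
     lhs ℚ.* fromℤ P         ≡⟨ cong (ℚ._* fromℤ P) lhs≡m ⟩
     fromℤ m ℚ.* fromℤ P     ≡⟨ fromℤ-homo-* m P ⟨
     fromℤ (m ℤ.* P)         ∎)))
  (λ (xs≢0 , defect≡0) → xs≢0 , *-cancelʳ-by-inverse {r = recip P} lhs (fromℤ m) (recip-*-fromℤ P (prodℤ≢0 xs≢0)) (begin
     lhs ℚ.* fromℤ P         ≡⟨ lhs-*-prodℤ xs≢0 ⟩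
     fromℤ (eₙ₋₁ xs ℤ.- s)   ≡⟨ cong fromℤ (ℤP.i-j≡0⇒i≡j (eₙ₋₁ xs ℤ.- s) (m ℤ.* P) defect≡0) ⟩
     fromℤ (m ℤ.* P)         ≡⟨ fromℤ-homo-* m P ⟩
     fromℤ m ℚ.* fromℤ P     ∎))
  where
  open ≡-Reasoning
  P = prodℤ xs
  lhs = recipSum xs ℚ.- fromℤ s ℚ.* recip P
  expand : ∀ R S r P → (R ℚ.- S ℚ.* r) ℚ.* P ≡ R ℚ.* P ℚ.- S ℚ.* (r ℚ.* P)
  expand = solve 4 (λ R S r P → (R :- S :* r) :* P := R :* P :- S :* (r :* P)) refl
    where open ℚSolver.+-*-Solver
  lhs-*-prodℤ : NonZeros xs → lhs ℚ.* fromℤ P ≡ fromℤ (eₙ₋₁ xs ℤ.- s)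
  lhs-*-prodℤ xs≢0 = begin
    lhs ℚ.* fromℤ P                                             ≡⟨ expand (recipSum xs) (fromℤ s) (recip P) (fromℤ P) ⟩
    recipSum xs ℚ.* fromℤ P ℚ.- fromℤ s ℚ.* (recip P ℚ.* fromℤ P)
      ≡⟨ cong₂ (λ a b → a ℚ.- fromℤ s ℚ.* b) (recipSum-*-prodℤ xs≢0) (recip-*-fromℤ P (prodℤ≢0 xs≢0)) ⟩
    fromℤ (eₙ₋₁ xs) ℚ.- fromℤ s ℚ.* 1ℚ                          ≡⟨ cong (λ a → fromℤ (eₙ₋₁ xs) ℚ.- a) (ℚP.*-identityʳ (fromℤ s)) ⟩
    fromℤ (eₙ₋₁ xs) ℚ.- fromℤ s                                 ≡⟨ fromℤ-homo-- (eₙ₋₁ xs) s ⟨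
    fromℤ (eₙ₋₁ xs ℤ.- s)                                       ∎

-- The algebra of eₙ₋₁

prodℤ-insert : ∀ {k n} (ys : Vec ℤ k) x (xs : Vec ℤ n) → prodℤ (ys ++ x ∷ xs) ≡ x ℤ.* prodℤ (ys ++ xs)
prodℤ-insert []       x xs = refl
prodℤ-insert (y ∷ ys) x xs = trans (cong (y ℤ.*_) (prodℤ-insert ys x xs)) (x∙yz≈y∙xz y x (prodℤ (ys ++ xs)))

eₙ₋₁-insert : ∀ {k n} (ys : Vec ℤ k) x (xs : Vec ℤ n) →
              eₙ₋₁ (ys ++ x ∷ xs) ≡ prodℤ (ys ++ xs) ℤ.+ x ℤ.* eₙ₋₁ (ys ++ xs)
eₙ₋₁-insert []       x xs = refl
eₙ₋₁-insert (y ∷ ys) x xs = begin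
  prodℤ (ys ++ x ∷ xs) ℤ.+ y ℤ.* eₙ₋₁ (ys ++ x ∷ xs)  ≡⟨ cong₂ (λ p e → p ℤ.+ y ℤ.* e) (prodℤ-insert ys x xs) (eₙ₋₁-insert ys x xs) ⟩
  x ℤ.* P ℤ.+ y ℤ.* (P ℤ.+ x ℤ.* e)                   ≡⟨ expand x y P e ⟩
  y ℤ.* P ℤ.+ x ℤ.* (P ℤ.+ y ℤ.* e)                   ∎
  where
  open ≡-Reasoning
  P = prodℤ (ys ++ xs)
  e = eₙ₋₁ (ys ++ xs)
  expand : ∀ x y P e → x ℤ.* P ℤ.+ y ℤ.* (P ℤ.+ x ℤ.* e) ≡ y ℤ.* P ℤ.+ x ℤ.* (P ℤ.+ y ℤ.* e)
  expand = solve-∀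

defect-insert : ∀ {k n} s m (ys : Vec ℤ k) x (xs : Vec ℤ n) → defect s m (ys ++ x ∷ xs) ≡ defect s m (x ∷ ys ++ xs)
defect-insert s m ys x xs = cong₂ (λ e p → e ℤ.- s ℤ.- m ℤ.* p) (eₙ₋₁-insert ys x xs) (prodℤ-insert ys x xs)

defect-cons-1 : ∀ {n} s m (xs : Vec ℤ n) → defect s m (1ℤ ∷ xs) ≡ defect s (m ℤ.- 1ℤ) xs
defect-cons-1 s m xs = expand (prodℤ xs) (eₙ₋₁ xs) s m
  where
  expand : ∀ P e s m → P ℤ.+ 1ℤ ℤ.* e ℤ.- s ℤ.- m ℤ.* (1ℤ ℤ.* P) ≡ e ℤ.- s ℤ.- (m ℤ.- 1ℤ) ℤ.* P
  expand = solve-∀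

defect-cons-‿1 : ∀ {n} s m (xs : Vec ℤ n) → defect s m (-1ℤ ∷ xs) ≡ - defect (- s) (m ℤ.+ 1ℤ) xs
defect-cons-‿1 s m xs = expand (prodℤ xs) (eₙ₋₁ xs) s m
  where
  expand : ∀ P e s m → P ℤ.+ -1ℤ ℤ.* e ℤ.- s ℤ.- m ℤ.* (-1ℤ ℤ.* P) ≡ - (e ℤ.- - s ℤ.- (m ℤ.+ 1ℤ) ℤ.* P)
  expand = solve-∀

negate : ∀ {n} → Vec ℤ n → Vec ℤ n
negate xs = map -_ xs

prodℤ-negate : ∀ {n} (xs : Vec ℤ n) → prodℤ (negate xs) ≡ -1ℤ ^ n ℤ.* prodℤ xs
prodℤ-negate []       = refl
prodℤ-negate {suc n} (x ∷ xs) = trans (cong (- x ℤ.*_) (prodℤ-negate xs)) (expand x (-1ℤ ^ n) (prodℤ xs))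
  where
  expand : ∀ x t P → - x ℤ.* (t ℤ.* P) ≡ -1ℤ ℤ.* t ℤ.* (x ℤ.* P)
  expand = solve-∀

eₙ₋₁-negate : ∀ {n} (xs : Vec ℤ n) → eₙ₋₁ (negate xs) ≡ - (-1ℤ ^ n) ℤ.* eₙ₋₁ xs
eₙ₋₁-negate []       = refl
eₙ₋₁-negate {suc n} (x ∷ xs) =
  trans (cong₂ (λ p e → p ℤ.+ - x ℤ.* e) (prodℤ-negate xs) (eₙ₋₁-negate xs)) (expand x (-1ℤ ^ n) (prodℤ xs) (eₙ₋₁ xs))
  where
  expand : ∀ x t P e → t ℤ.* P ℤ.+ - x ℤ.* (- t ℤ.* e) ≡ - (-1ℤ ℤ.* t) ℤ.* (P ℤ.+ x ℤ.* e)
  expand = solve-∀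

defect-negate : ∀ {n} s m (xs : Vec ℤ n) →
                defect (- (-1ℤ ^ n) ℤ.* s) (- m) (negate xs) ≡ - (-1ℤ ^ n) ℤ.* defect s m xs
defect-negate {n} s m xs =
  trans (cong₂ (λ e p → e ℤ.- - (-1ℤ ^ n) ℤ.* s ℤ.- - m ℤ.* p) (eₙ₋₁-negate xs) (prodℤ-negate xs))
        (expand (-1ℤ ^ n) (eₙ₋₁ xs) (prodℤ xs) s m)
  where
  expand : ∀ t e P s m → - t ℤ.* e ℤ.- - t ℤ.* s ℤ.- - m ℤ.* (t ℤ.* P) ≡ - t ℤ.* (e ℤ.- s ℤ.- m ℤ.* P)
  expand = solve-∀

-‿-1^[1+n]≡-1^n : ∀ n → - (-1ℤ ^ suc n) ≡ -1ℤ ^ n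
-‿-1^[1+n]≡-1^n n = trans (cong -_ (ℤP.-1*i≡-i _)) (ℤP.neg-involutive _)

-1^n*-1^n≡1 : ∀ n → -1ℤ ^ n ℤ.* -1ℤ ^ n ≡ 1ℤ
-1^n*-1^n≡1 zero    = refl
-1^n*-1^n≡1 (suc n) = trans (expand (-1ℤ ^ n)) (-1^n*-1^n≡1 n)
  where
  expand : ∀ t → -1ℤ ℤ.* t ℤ.* (-1ℤ ℤ.* t) ≡ t ℤ.* t
  expand = solve-∀

-1^n*i≡1⇒i≡-1^n : ∀ n i → -1ℤ ^ n ℤ.* i ≡ 1ℤ → i ≡ -1ℤ ^ n
-1^n*i≡1⇒i≡-1^n n i ti≡1 = begin
  i                ≡⟨ ℤP.*-identityˡ i ⟨
  1ℤ ℤ.* i         ≡⟨ cong (ℤ._* i) (-1^n*-1^n≡1 n) ⟨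
  t ℤ.* t ℤ.* i    ≡⟨ ℤP.*-assoc t t i ⟩
  t ℤ.* (t ℤ.* i)  ≡⟨ cong (t ℤ.*_) ti≡1 ⟩
  t ℤ.* 1ℤ         ≡⟨ ℤP.*-identityʳ t ⟩
  t                ∎
  where
  open ≡-Reasoning
  t = -1ℤ ^ n

-- Infinite families of solutions

height : ∀ {n} → Vec ℤ n → ℕ
height xs = sum (map ∣_∣ xs)

Unbounded : ∀ {n} → (Vec ℤ n → Set) → Set
Unbounded P = ∀ B → ∃ λ xs → P xs × B ≤ height xs

Unbounded⇒Infinite : ∀ {n} {P : Vec ℤ n → Set} → Unbounded P → Infinite P
Unbounded⇒Infinite unbounded (l , complete) =
  let B = max 0 (List.map height l)
      xs , Pxs , B<height = unbounded (suc B)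
  in  ℕP.<⇒≱ B<height (ListAll.lookup (xs≤max 0 (List.map height l)) (∈-map⁺ height (complete xs Pxs)))

Unbounded-map : ∀ {n n′} {P : Vec ℤ n → Set} {Q : Vec ℤ n′ → Set} (f : Vec ℤ n → Vec ℤ n′) →
                (∀ xs → height xs ≤ height (f xs)) → (∀ {xs} → P xs → Q (f xs)) → Unbounded P → Unbounded Q
Unbounded-map f height-≤ P⇒Q unbounded B =
  let xs , Pxs , B≤height = unbounded B
  in  f xs , P⇒Q Pxs , ℕP.≤-trans B≤height (height-≤ xs)

Unbounded-cons-1 : ∀ {n} s m → Unbounded (IsSolutionℤ {n} s (m ℤ.- 1ℤ)) → Unbounded (IsSolutionℤ s m)
Unbounded-cons-1 s m = Unbounded-map (1ℤ ∷_) (λ _ → ℕP.m≤n+m _ 1)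
  λ {xs} (xs≢0 , defect≡0) → (λ ()) ∷ xs≢0 , trans (defect-cons-1 s m xs) defect≡0

Unbounded-cons-‿1 : ∀ {n} s m → Unbounded (IsSolutionℤ {n} (- s) (m ℤ.+ 1ℤ)) → Unbounded (IsSolutionℤ s m)
Unbounded-cons-‿1 s m = Unbounded-map (-1ℤ ∷_) (λ _ → ℕP.m≤n+m _ 1)
  λ {xs} (xs≢0 , defect≡0) → (λ ()) ∷ xs≢0 , trans (defect-cons-‿1 s m xs) (cong -_ defect≡0)

∣i∣<∣j∣⇒i+j≢0 : ∀ i j → ∣ i ∣ < ∣ j ∣ → i ℤ.+ j ≢ 0ℤ
∣i∣<∣j∣⇒i+j≢0 i j ∣i∣<∣j∣ i+j≡0 = ℕP.<⇒≢ ∣i∣<∣j∣ (begin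
  ∣ i ∣         ≡⟨ ℤP.∣-i∣≡∣i∣ i ⟨
  ∣ - i ∣     ≡⟨ cong ∣_∣ (inverseʳ-unique i j i+j≡0) ⟨
  ∣ j ∣         ∎)
  where open ≡-Reasoning

Unbounded-2 : ∀ s → Unbounded (IsSolutionℤ {2} s 0ℤ)
Unbounded-2 s B = t ∷ s ℤ.- t ∷ [] , ((λ ()) ∷ s-t≢0 ∷ [] , solves t s) , B≤height
  where
  t = + suc (∣ s ∣ ℕ.+ B)
  s-t≢0 : s ℤ.- t ≢ 0ℤ
  s-t≢0 = ∣i∣<∣j∣⇒i+j≢0 s (- t) (s≤s (ℕP.m≤m+n ∣ s ∣ B))
  B≤height : B ≤ height (t ∷ s ℤ.- t ∷ [])
  B≤height = ℕP.≤-trans (ℕP.m≤n+m B (suc ∣ s ∣)) (ℕP.m≤m+n _ _)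
  -- The ring solver does not unfold defect, so the unfolding is spelled out.
  solves : ∀ t s → defect s 0ℤ (t ∷ s ℤ.- t ∷ []) ≡ 0ℤ
  solves = expand
    where
    expand : ∀ t s → (s ℤ.- t) ℤ.* 1ℤ ℤ.+ t ℤ.* (1ℤ ℤ.+ (s ℤ.- t) ℤ.* 0ℤ) ℤ.- s ℤ.- 0ℤ ℤ.* (t ℤ.* ((s ℤ.- t) ℤ.* 1ℤ)) ≡ 0ℤ
    expand = solve-∀

Unbounded-3 : ∀ s → Unbounded (IsSolutionℤ {3} s 0ℤ)
Unbounded-3 s B = x ∷ 1ℤ ℤ.- x ∷ c ∷ [] , ((λ ()) ∷ (λ ()) ∷ c≢0 ∷ [] , solves x s) , B≤height
  where
  k = ∣ s ∣ ℕ.+ B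
  x = + (2 ℕ.+ k)
  c = s ℤ.+ x ℤ.* (x ℤ.- 1ℤ)
  c≢0 : c ≢ 0ℤ
  c≢0 = ∣i∣<∣j∣⇒i+j≢0 s (x ℤ.* (x ℤ.- 1ℤ)) (ℕP.≤-trans (s≤s (ℕP.m≤m+n ∣ s ∣ B)) (ℕP.m≤n*m (suc k) (2 ℕ.+ k)))
  B≤height : B ≤ height (x ∷ 1ℤ ℤ.- x ∷ c ∷ [])
  B≤height = ℕP.≤-trans (ℕP.m≤n+m B (2 ℕ.+ ∣ s ∣)) (ℕP.m≤m+n _ _)
  solves : ∀ x s → defect s 0ℤ (x ∷ 1ℤ ℤ.- x ∷ s ℤ.+ x ℤ.* (x ℤ.- 1ℤ) ∷ []) ≡ 0ℤ
  solves = expand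
    where
    expand : ∀ x s → let b = 1ℤ ℤ.- x ; c = s ℤ.+ x ℤ.* (x ℤ.- 1ℤ) in
             b ℤ.* (c ℤ.* 1ℤ) ℤ.+ x ℤ.* (c ℤ.* 1ℤ ℤ.+ b ℤ.* (1ℤ ℤ.+ c ℤ.* 0ℤ)) ℤ.- s ℤ.- 0ℤ ℤ.* (x ℤ.* (b ℤ.* (c ℤ.* 1ℤ))) ≡ 0ℤ
    expand = solve-∀

Unbounded-within : ∀ N s m → ∣ m ∣ ≤ N → Unbounded (IsSolutionℤ {2 ℕ.+ N} s m)
Unbounded-within zero          s (+ zero)        _         = Unbounded-2 s
Unbounded-within (suc zero)    s (+ zero)        _         = Unbounded-3 s
Unbounded-within (suc (suc N)) s (+ zero)        _         = Unbounded-cons-1 s 0ℤ (Unbounded-within (suc N) s -1ℤ (s≤s z≤n))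
Unbounded-within (suc N)       s +[1+ k ]        (s≤s k≤N) = Unbounded-cons-1 s +[1+ k ] (Unbounded-within N s (+ k) k≤N)
Unbounded-within (suc N)       s -[1+ zero ]     _         = Unbounded-cons-‿1 s -1ℤ (Unbounded-within N (- s) 0ℤ z≤n)
Unbounded-within (suc N)       s -[1+ suc k ]    (s≤s k<N) = Unbounded-cons-‿1 s -[1+ suc k ] (Unbounded-within N (- s) -[1+ k ] k<N)

Unbounded-1 : Unbounded (IsSolutionℤ {1} 1ℤ 0ℤ)
Unbounded-1 B = +[1+ B ] ∷ [] , ((λ ()) ∷ [] , solves +[1+ B ]) , ℕP.≤-trans (ℕP.n≤1+n B) (ℕP.m≤m+n _ 0)
  where
  solves : ∀ x → defect 1ℤ 0ℤ (x ∷ []) ≡ 0ℤ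
  solves = expand
    where
    expand : ∀ x → 1ℤ ℤ.+ x ℤ.* 0ℤ ℤ.- 1ℤ ℤ.- 0ℤ ℤ.* (x ℤ.* 1ℤ) ≡ 0ℤ
    expand = solve-∀

Unbounded-m≡n-1 : ∀ n → Unbounded (IsSolutionℤ {suc n} 1ℤ (+ n))
Unbounded-m≡n-1 zero    = Unbounded-1
Unbounded-m≡n-1 (suc n) = Unbounded-cons-1 1ℤ (+ suc n) (Unbounded-m≡n-1 n)

Unbounded-m≡1-n : ∀ n → Unbounded (IsSolutionℤ {suc n} (-1ℤ ^ n) (- + n))
Unbounded-m≡1-n zero    = Unbounded-1
Unbounded-m≡1-n (suc n) = Unbounded-cons-‿1 (-1ℤ ^ suc n) (- + suc n) (subst₂ (λ s m → Unbounded (IsSolutionℤ {suc n} s m))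
  (sym (-‿-1^[1+n]≡-1^n n)) (sym (-[1+n]+1≡-n n)) (Unbounded-m≡1-n n))
  where
  -[1+n]+1≡-n : ∀ n → -[1+ n ] ℤ.+ 1ℤ ≡ - + n
  -[1+n]+1≡-n zero    = refl
  -[1+n]+1≡-n (suc n) = refl

-- Bounding the solutions

Big : ℤ → Set
Big x = 2 ≤ ∣ x ∣

unit-or-big : ∀ x → x ≢ 0ℤ → x ≡ 1ℤ ⊎ x ≡ -1ℤ ⊎ Big x
unit-or-big (+ zero)       x≢0 = ⊥-elim (x≢0 refl)
unit-or-big +[1+ zero ]    _   = inj₁ refl
unit-or-big -[1+ zero ]    _   = inj₂ (inj₁ refl)
unit-or-big +[1+ suc _ ]   _   = inj₂ (inj₂ (s≤s (s≤s z≤n)))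
unit-or-big -[1+ suc _ ]   _   = inj₂ (inj₂ (s≤s (s≤s z≤n)))

∣i∣≤∣i*j∣ : ∀ i j → i ℤ.* j ≢ 0ℤ → ∣ i ∣ ≤ ∣ i ℤ.* j ∣
∣i∣≤∣i*j∣ i (+ zero)    ij≢0 = ⊥-elim (ij≢0 (ℤP.*-zeroʳ i))
∣i∣≤∣i*j∣ i j@(+[1+ _ ]) _   = ℕP.≤-trans (ℕP.m≤m*n ∣ i ∣ ∣ j ∣) (ℕP.≤-reflexive (sym (ℤP.abs-* i j)))
∣i∣≤∣i*j∣ i j@(-[1+ _ ]) _   = ℕP.≤-trans (ℕP.m≤m*n ∣ i ∣ ∣ j ∣) (ℕP.≤-reflexive (sym (ℤP.abs-* i j)))

∣entry∣≤∣prodℤ∣ : ∀ {n} {xs : Vec ℤ n} → NonZeros xs → All (λ x → ∣ x ∣ ≤ ∣ prodℤ xs ∣) xs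
∣entry∣≤∣prodℤ∣ [] = []
∣entry∣≤∣prodℤ∣ {xs = x ∷ xs} xs≢0@(_ ∷ xs′≢0) =
  ∣i∣≤∣i*j∣ x (prodℤ xs) xP≢0 ∷ All.map (λ ∣y∣≤∣P∣ → ℕP.≤-trans ∣y∣≤∣P∣ ∣P∣≤∣xP∣) (∣entry∣≤∣prodℤ∣ xs′≢0)
  where
  xP≢0 = prodℤ≢0 xs≢0
  ∣P∣≤∣xP∣ : ∣ prodℤ xs ∣ ≤ ∣ x ℤ.* prodℤ xs ∣
  ∣P∣≤∣xP∣ = subst (λ c → ∣ prodℤ xs ∣ ≤ ∣ c ∣) (ℤP.*-comm (prodℤ xs) x)
                   (∣i∣≤∣i*j∣ (prodℤ xs) x (xP≢0 ∘ trans (ℤP.*-comm x (prodℤ xs))))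

2∣eₙ₋₁∣≤k∣prodℤ∣ : ∀ {k} {ys : Vec ℤ k} → All Big ys → 2 ℕ.* ∣ eₙ₋₁ ys ∣ ≤ k ℕ.* ∣ prodℤ ys ∣
2∣eₙ₋₁∣≤k∣prodℤ∣ [] = z≤n
2∣eₙ₋₁∣≤k∣prodℤ∣ {suc k} {y ∷ ys} (2≤∣y∣ ∷ bigs) = begin
  2 ℕ.* ∣ prodℤ ys ℤ.+ y ℤ.* eₙ₋₁ ys ∣ ≤⟨ ℕP.*-monoʳ-≤ 2 (ℤP.∣i+j∣≤∣i∣+∣j∣ (prodℤ ys) (y ℤ.* eₙ₋₁ ys)) ⟩
  2 ℕ.* (p ℕ.+ ∣ y ℤ.* eₙ₋₁ ys ∣)      ≡⟨ cong (λ z → 2 ℕ.* (p ℕ.+ z)) (ℤP.abs-* y (eₙ₋₁ ys)) ⟩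
  2 ℕ.* (p ℕ.+ a ℕ.* e)                   ≡⟨ distrib p a e ⟩
  2 ℕ.* p ℕ.+ a ℕ.* (2 ℕ.* e)             ≤⟨ ℕP.+-mono-≤ (ℕP.*-monoˡ-≤ p 2≤∣y∣) (ℕP.*-monoʳ-≤ a (2∣eₙ₋₁∣≤k∣prodℤ∣ bigs)) ⟩
  a ℕ.* p ℕ.+ a ℕ.* (k ℕ.* p)             ≡⟨ collect a p k ⟩
  suc k ℕ.* (a ℕ.* p)                     ≡⟨ cong (suc k ℕ.*_) (ℤP.abs-* y (prodℤ ys)) ⟨
  suc k ℕ.* ∣ y ℤ.* prodℤ ys ∣          ∎
  where
  open ℕP.≤-Reasoning
  p = ∣ prodℤ ys ∣
  e = ∣ eₙ₋₁ ys ∣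
  a = ∣ y ∣
  distrib : ∀ p a e → 2 ℕ.* (p ℕ.+ a ℕ.* e) ≡ 2 ℕ.* p ℕ.+ a ℕ.* (2 ℕ.* e)
  distrib = ℕRing.solve-∀
  collect : ∀ a p k → a ℕ.* p ℕ.+ a ℕ.* (k ℕ.* p) ≡ suc k ℕ.* (a ℕ.* p)
  collect = ℕRing.solve-∀

solutionBound : ℕ → ℕ
solutionBound a = (2 ℕ.+ a) ℕ.* (2 ℕ.+ a)

1≤solutionBound : ∀ a → 1 ≤ solutionBound a
1≤solutionBound a = ℕP.≤-trans (s≤s z≤n) (ℕP.m≤m*n (2 ℕ.+ a) (2 ℕ.+ a))

2a≤solutionBound : ∀ a → 2 ℕ.* a ≤ solutionBound a
2a≤solutionBound a = ℕP.*-mono-≤ {2} {2 ℕ.+ a} (s≤s (s≤s z≤n)) (ℕP.m≤n+m a 2)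

∣prodℤ∣≤2∣s∣ : ∀ {k} {ys : Vec ℤ k} s M → All Big ys → defect s (+ M) ys ≡ 0ℤ → suc k ≤ 2 ℕ.* M →
               ∣ prodℤ ys ∣ ≤ 2 ℕ.* ∣ s ∣
∣prodℤ∣≤2∣s∣ {k} {ys} s M bigs defect≡0 1+k≤2M = ℕP.+-cancelˡ-≤ (k ℕ.* p) p (2 ℕ.* a) (begin
  k ℕ.* p ℕ.+ p                   ≡⟨ ℕP.+-comm (k ℕ.* p) p ⟩
  suc k ℕ.* p                     ≤⟨ ℕP.*-monoˡ-≤ p 1+k≤2M ⟩
  2 ℕ.* M ℕ.* p                   ≡⟨ ℕP.*-assoc 2 M p ⟩
  2 ℕ.* (M ℕ.* p)                 ≡⟨ cong (2 ℕ.*_) (ℤP.abs-* (+ M) (prodℤ ys)) ⟨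
  2 ℕ.* ∣ + M ℤ.* prodℤ ys ∣    ≡⟨ cong (λ z → 2 ℕ.* ∣ z ∣) (ℤP.i-j≡0⇒i≡j (eₙ₋₁ ys ℤ.- s) (+ M ℤ.* prodℤ ys) defect≡0) ⟨
  2 ℕ.* ∣ eₙ₋₁ ys ℤ.- s ∣       ≤⟨ ℕP.*-monoʳ-≤ 2 (ℤP.∣i-j∣≤∣i∣+∣j∣ (eₙ₋₁ ys) s) ⟩
  2 ℕ.* (∣ eₙ₋₁ ys ∣ ℕ.+ a)     ≡⟨ ℕP.*-distribˡ-+ 2 ∣ eₙ₋₁ ys ∣ a ⟩
  2 ℕ.* ∣ eₙ₋₁ ys ∣ ℕ.+ 2 ℕ.* a ≤⟨ ℕP.+-monoˡ-≤ (2 ℕ.* a) (2∣eₙ₋₁∣≤k∣prodℤ∣ bigs) ⟩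
  k ℕ.* p ℕ.+ 2 ℕ.* a             ∎)
  where
  open ℕP.≤-Reasoning
  p = ∣ prodℤ ys ∣
  a = ∣ s ∣

∣i∣≤2+∣s∣ : ∀ i s → ∣ i ℤ.- 1ℤ ∣ ≤ ∣ 1ℤ ℤ.- s ∣ → ∣ i ∣ ≤ 2 ℕ.+ ∣ s ∣
∣i∣≤2+∣s∣ i s ∣i-1∣≤∣1-s∣ = begin
  ∣ i ∣                     ≡⟨ cong ∣_∣ (i≡i-1+1 i) ⟩
  ∣ i ℤ.- 1ℤ ℤ.+ 1ℤ ∣       ≤⟨ ℤP.∣i+j∣≤∣i∣+∣j∣ (i ℤ.- 1ℤ) 1ℤ ⟩
  ∣ i ℤ.- 1ℤ ∣ ℕ.+ 1        ≤⟨ ℕP.+-monoˡ-≤ 1 (ℕP.≤-trans ∣i-1∣≤∣1-s∣ (ℤP.∣i-j∣≤∣i∣+∣j∣ 1ℤ s)) ⟩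
  suc ∣ s ∣ ℕ.+ 1           ≡⟨ ℕP.+-comm (suc ∣ s ∣) 1 ⟩
  2 ℕ.+ ∣ s ∣               ∎
  where
  open ℕP.≤-Reasoning
  i≡i-1+1 : ∀ i → i ≡ i ℤ.- 1ℤ ℤ.+ 1ℤ
  i≡i-1+1 = solve-∀

∣prodℤ∣≤bound-pair : ∀ y z s → s ≢ 1ℤ → defect s 1ℤ (y ∷ z ∷ []) ≡ 0ℤ →
                     ∣ prodℤ (y ∷ z ∷ []) ∣ ≤ solutionBound ∣ s ∣
∣prodℤ∣≤bound-pair y z s s≢1 defect≡0 = begin
  ∣ y ℤ.* (z ℤ.* 1ℤ) ∣         ≡⟨ trans (ℤP.abs-* y (z ℤ.* 1ℤ)) (cong (λ w → ∣ y ∣ ℕ.* ∣ w ∣) (ℤP.*-identityʳ z)) ⟩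
  ∣ y ∣ ℕ.* ∣ z ∣            ≤⟨ ℕP.*-mono-≤ (∣i∣≤2+∣s∣ y s (∣factor∣≤∣1-s∣ (y ℤ.- 1ℤ) _ factor)) (∣i∣≤2+∣s∣ z s (∣factor∣≤∣1-s∣ (z ℤ.- 1ℤ) _ factor′)) ⟩
  solutionBound ∣ s ∣          ∎
  where
  open ℕP.≤-Reasoning
  1-s≢0 : 1ℤ ℤ.- s ≢ 0ℤ
  1-s≢0 1-s≡0 = s≢1 (sym (ℤP.i-j≡0⇒i≡j 1ℤ s 1-s≡0))
  expand : ∀ y z s → (y ℤ.- 1ℤ) ℤ.* (z ℤ.- 1ℤ) ≡
           1ℤ ℤ.- s ℤ.- ((z ℤ.* 1ℤ ℤ.+ y ℤ.* (1ℤ ℤ.+ z ℤ.* 0ℤ)) ℤ.- s ℤ.- 1ℤ ℤ.* (y ℤ.* (z ℤ.* 1ℤ)))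
  expand = solve-∀
  factor : (y ℤ.- 1ℤ) ℤ.* (z ℤ.- 1ℤ) ≡ 1ℤ ℤ.- s
  factor = trans (expand y z s) (trans (cong (λ d → 1ℤ ℤ.- s ℤ.- d) defect≡0) (ℤP.+-identityʳ (1ℤ ℤ.- s)))
  factor′ : (z ℤ.- 1ℤ) ℤ.* (y ℤ.- 1ℤ) ≡ 1ℤ ℤ.- s
  factor′ = trans (ℤP.*-comm (z ℤ.- 1ℤ) (y ℤ.- 1ℤ)) factor
  ∣factor∣≤∣1-s∣ : ∀ i j → i ℤ.* j ≡ 1ℤ ℤ.- s → ∣ i ∣ ≤ ∣ 1ℤ ℤ.- s ∣
  ∣factor∣≤∣1-s∣ i j ij≡1-s =
    subst (λ c → ∣ i ∣ ≤ ∣ c ∣) ij≡1-s (∣i∣≤∣i*j∣ i j (λ ij≡0 → 1-s≢0 (trans (sym ij≡1-s) ij≡0)))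

∣prodℤ∣≤bound-big : ∀ {k} (ys : Vec ℤ k) s M → All Big ys → defect s (+ M ℤ.- 1ℤ) ys ≡ 0ℤ →
                    k ≤ M → ¬ (M ≡ k × s ≡ 1ℤ) → ∣ prodℤ ys ∣ ≤ solutionBound ∣ s ∣
∣prodℤ∣≤bound-big [] s M _ _ _ _ = 1≤solutionBound ∣ s ∣
∣prodℤ∣≤bound-big (y ∷ []) s (suc zero) _ defect≡0 _ unexceptional =
  ⊥-elim (unexceptional (refl , sym (ℤP.i-j≡0⇒i≡j 1ℤ s (trans (sym (defect-singleton y s)) defect≡0))))
  where
  defect-singleton : ∀ y s → defect s 0ℤ (y ∷ []) ≡ 1ℤ ℤ.- s
  defect-singleton = expand
    where
    expand : ∀ y s → 1ℤ ℤ.+ y ℤ.* 0ℤ ℤ.- s ℤ.- 0ℤ ℤ.* (y ℤ.* 1ℤ) ≡ 1ℤ ℤ.- s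
    expand = solve-∀
∣prodℤ∣≤bound-big (y ∷ []) s (suc (suc M)) bigs defect≡0 _ _ =
  ℕP.≤-trans (∣prodℤ∣≤2∣s∣ s (suc M) bigs defect≡0 (ℕP.*-monoʳ-≤ 2 (s≤s z≤n))) (2a≤solutionBound ∣ s ∣)
∣prodℤ∣≤bound-big (y ∷ z ∷ []) s (suc zero) _ _ (s≤s ()) _
∣prodℤ∣≤bound-big (y ∷ z ∷ []) s (suc (suc zero)) _ defect≡0 _ unexceptional =
  ∣prodℤ∣≤bound-pair y z s (λ s≡1 → unexceptional (refl , s≡1)) defect≡0
∣prodℤ∣≤bound-big (y ∷ z ∷ []) s (suc (suc (suc M))) bigs defect≡0 _ _ =
  ℕP.≤-trans (∣prodℤ∣≤2∣s∣ s (suc (suc M)) bigs defect≡0 (ℕP.≤-trans (ℕP.n≤1+n 3) (ℕP.*-monoʳ-≤ 2 (s≤s (s≤s z≤n)))))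
             (2a≤solutionBound ∣ s ∣)
∣prodℤ∣≤bound-big {suc (suc (suc k))} (y ∷ z ∷ w ∷ ys) s (suc M) bigs defect≡0 (s≤s 2+k≤M) _ =
  ℕP.≤-trans (∣prodℤ∣≤2∣s∣ s M bigs defect≡0 4+k≤2M) (2a≤solutionBound ∣ s ∣)
  where
  4+k≤2M : 4 ℕ.+ k ≤ 2 ℕ.* M
  4+k≤2M = ℕP.≤-trans (ℕP.+-mono-≤ (ℕP.≤-trans (ℕP.m≤m+n 2 k) 2+k≤M) 2+k≤M) (ℕP.≤-reflexive (M+M≡2M M))
    where
    M+M≡2M : ∀ M → M ℕ.+ M ≡ 2 ℕ.* M
    M+M≡2M = ℕRing.solve-∀

-- The entries of absolute value ≥ 2 met so far are moved into ys.  Removing an entry 1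
-- lowers m and the length together; removing −1 negates s and raises m, which leaves
-- the exceptional case behind.
∣prodℤ∣≤bound : ∀ {k n} (ys : Vec ℤ k) (xs : Vec ℤ n) s M → All Big ys → NonZeros xs →
                defect s (+ M ℤ.- 1ℤ) (ys ++ xs) ≡ 0ℤ → n ℕ.+ k ≤ M → ¬ (M ≡ n ℕ.+ k × s ≡ 1ℤ) →
                ∣ prodℤ (ys ++ xs) ∣ ≤ solutionBound ∣ s ∣
∣prodℤ∣≤bound {k} ys [] s M bigs [] defect≡0 k≤M unexceptional =
  ∣prodℤ∣≤bound-big (ys ++ []) s M (++⁺ bigs []) defect≡0 (subst (_≤ M) (sym (ℕP.+-identityʳ k)) k≤M)
    λ (M≡k+0 , s≡1) → unexceptional (trans M≡k+0 (ℕP.+-identityʳ k) , s≡1)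
∣prodℤ∣≤bound {k} {suc n} ys (x ∷ xs) s (suc M) bigs (x≢0 ∷ xs≢0) defect≡0 (s≤s n+k≤M) unexceptional
  with unit-or-big x x≢0 | trans (sym (defect-insert s (+ M) ys x xs)) defect≡0
... | inj₁ refl | moved =
  subst (_≤ solutionBound ∣ s ∣) (cong ∣_∣ (sym (trans (prodℤ-insert ys 1ℤ xs) (ℤP.*-identityˡ _))))
    (∣prodℤ∣≤bound ys xs s M bigs xs≢0 (trans (sym (defect-cons-1 s (+ M) (ys ++ xs))) moved) n+k≤M
      λ (M≡n+k , s≡1) → unexceptional (cong suc M≡n+k , s≡1))
... | inj₂ (inj₁ refl) | moved =
  subst₂ _≤_ (trans (sym (ℤP.∣-i∣≡∣i∣ (prodℤ (ys ++ xs)))) (cong ∣_∣ (sym (trans (prodℤ-insert ys -1ℤ xs) (ℤP.-1*i≡-i _)))))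
             (cong solutionBound (ℤP.∣-i∣≡∣i∣ s))
    (∣prodℤ∣≤bound ys xs (- s) (suc (suc M)) bigs xs≢0 defect′≡0
      (ℕP.≤-trans n+k≤M (ℕP.≤-trans (ℕP.n≤1+n M) (ℕP.n≤1+n (suc M))))
      λ (2+M≡n+k , _) → ℕP.<⇒≢ (s≤s (ℕP.≤-trans n+k≤M (ℕP.n≤1+n M))) (sym 2+M≡n+k))
  where
  defect′≡0 : defect (- s) (+ suc M) (ys ++ xs) ≡ 0ℤ
  defect′≡0 = subst (λ a → defect (- s) (+ a) (ys ++ xs) ≡ 0ℤ) (ℕP.+-comm M 1)
    (trans (sym (ℤP.neg-involutive _)) (cong -_ (trans (sym (defect-cons-‿1 s (+ M) (ys ++ xs))) moved)))
... | inj₂ (inj₂ big) | moved =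
  subst (_≤ solutionBound ∣ s ∣) (cong ∣_∣ (sym (prodℤ-insert ys x xs)))
    (∣prodℤ∣≤bound (x ∷ ys) xs s (suc M) (big ∷ bigs) xs≢0 moved (subst (_≤ suc M) (sym (ℕP.+-suc n k)) (s≤s n+k≤M))
      λ (1+M≡n+1+k , s≡1) → unexceptional (trans 1+M≡n+1+k (ℕP.+-suc n k) , s≡1))

-- Finitely many solutions

intsWithin : ℕ → List ℤ
intsWithin c = List.applyUpTo +_ (suc c) List.++ List.applyUpTo -[1+_] c

∈-intsWithin : ∀ {c} x → ∣ x ∣ ≤ c → x ∈ intsWithin c
∈-intsWithin (+ i)    i≤c = ∈-++⁺ˡ (∈-applyUpTo⁺ +_ (s≤s i≤c))
∈-intsWithin -[1+ i ] i<c = ∈-++⁺ʳ _ (∈-applyUpTo⁺ -[1+_] i<c)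

vecsWithin : ℕ → (n : ℕ) → List (Vec ℤ n)
vecsWithin c zero    = List.[ [] ]
vecsWithin c (suc n) = List.cartesianProductWith _∷_ (intsWithin c) (vecsWithin c n)

∈-vecsWithin : ∀ {c n} {xs : Vec ℤ n} → All (λ x → ∣ x ∣ ≤ c) xs → xs ∈ vecsWithin c n
∈-vecsWithin []                    = here refl
∈-vecsWithin {xs = x ∷ _} (x≤c ∷ xs≤c) = ∈-cartesianProductWith⁺ _∷_ (∈-intsWithin x x≤c) (∈-vecsWithin xs≤c)

Finite-bounded : ∀ {n} {P : Vec ℤ n → Set} c → (∀ xs → P xs → All (λ x → ∣ x ∣ ≤ c) xs) → Finite P
Finite-bounded c bounded = vecsWithin c _ , λ xs Pxs → ∈-vecsWithin (bounded xs Pxs)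

Finite-above : ∀ n s M → n ≤ M → ¬ (M ≡ n × s ≡ 1ℤ) → Finite (IsSolution n s (+ M ℤ.- 1ℤ))
Finite-above n s M n≤M unexceptional = Finite-bounded (solutionBound ∣ s ∣) λ xs solution →
  let xs≢0 , defect≡0 = Equivalence.to (IsSolution⇔IsSolutionℤ s (+ M ℤ.- 1ℤ) xs) solution
      ∣P∣≤bound = ∣prodℤ∣≤bound [] xs s M [] xs≢0 defect≡0 (subst (_≤ M) (sym (ℕP.+-identityʳ n)) n≤M)
                    λ (M≡n+0 , s≡1) → unexceptional (trans M≡n+0 (ℕP.+-identityʳ n) , s≡1)
  in  All.map (λ ∣x∣≤∣P∣ → ℕP.≤-trans ∣x∣≤∣P∣ ∣P∣≤bound) (∣entry∣≤∣prodℤ∣ xs≢0)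

IsSolutionℤ-negate : ∀ {n} {s m} {xs : Vec ℤ n} → IsSolutionℤ s m xs →
                     IsSolutionℤ (- (-1ℤ ^ n) ℤ.* s) (- m) (negate xs)
IsSolutionℤ-negate {n} {s} {m} {xs} (xs≢0 , defect≡0) =
  map⁺ (All.map (λ {x} x≢0 -x≡0 → x≢0 (trans (sym (ℤP.neg-involutive x)) (cong -_ -x≡0))) xs≢0) ,
  trans (defect-negate s m xs) (trans (cong (- (-1ℤ ^ n) ℤ.*_) defect≡0) (ℤP.*-zeroʳ (- (-1ℤ ^ n))))

Finite-negate : ∀ {n} s m → Finite (IsSolution n (- (-1ℤ ^ n) ℤ.* s) (- m)) → Finite (IsSolution n s m)
Finite-negate s m (l , complete) = List.map negate l , λ xs solution →
  subst (_∈ _) (negate-involutive xs)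
    (∈-map⁺ negate (complete (negate xs)
      (Equivalence.from (IsSolution⇔IsSolutionℤ _ (- m) (negate xs)) (IsSolutionℤ-negate {s = s} {m} (Equivalence.to (IsSolution⇔IsSolutionℤ s m xs) solution)))))
  where
  negate-involutive : ∀ {n} (xs : Vec ℤ n) → negate (negate xs) ≡ xs
  negate-involutive xs = trans (sym (map-∘ -_ -_ xs)) (trans (map-cong ℤP.neg-involutive xs) (map-id xs))

Criterion : ℕ → ℤ → ℤ → Set
Criterion n s m = ∣ m ∣ ≤ n ∸ 2 ⊎ (m ≡ + (n ∸ 1) × s ≡ + 1) ⊎ (m ≡ - (+ (n ∸ 1)) × s ≡ (- (+ 1)) ^ (n ∸ 1))

criterion? : ∀ n s m → Dec (Criterion n s m)
criterion? n s m =
  ∣ m ∣ ℕ.≤? n ∸ 2 ⊎-dec (m ℤ.≟ + (n ∸ 1) ×-dec s ℤ.≟ + 1) ⊎-dec (m ℤ.≟ - (+ (n ∸ 1)) ×-dec s ℤ.≟ (- (+ 1)) ^ (n ∸ 1))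

Criterion⇒Unbounded : ∀ n s m → Criterion (2 ℕ.+ n) s m → Unbounded (IsSolutionℤ {2 ℕ.+ n} s m)
Criterion⇒Unbounded n s m (inj₁ ∣m∣≤n)                = Unbounded-within n s m ∣m∣≤n
Criterion⇒Unbounded n s _ (inj₂ (inj₁ (refl , refl))) = Unbounded-m≡n-1 (suc n)
Criterion⇒Unbounded n s _ (inj₂ (inj₂ (refl , refl))) = Unbounded-m≡1-n (suc n)

¬Criterion⇒Finite : ∀ n s m → ¬ Criterion (2 ℕ.+ n) s m → Finite (IsSolution (2 ℕ.+ n) s m)
¬Criterion⇒Finite n s (+ M) ¬criterion =
  Finite-above (2 ℕ.+ n) s (suc M) (s≤s (ℕP.≰⇒> (¬criterion ∘ inj₁)))
    λ (1+M≡2+n , s≡1) → ¬criterion (inj₂ (inj₁ (cong +_ (ℕP.suc-injective 1+M≡2+n) , s≡1)))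
¬Criterion⇒Finite n s -[1+ j ] ¬criterion =
  Finite-negate s -[1+ j ] (Finite-above (2 ℕ.+ n) _ (2 ℕ.+ j) (s≤s (ℕP.≰⇒> (¬criterion ∘ inj₁)))
    λ (2+j≡2+n , s′≡1) → ¬criterion (inj₂ (inj₂
      ( cong -[1+_] (ℕP.suc-injective (ℕP.suc-injective 2+j≡2+n))
      , -1^n*i≡1⇒i≡-1^n (suc n) s (trans (cong (ℤ._* s) (sym (-‿-1^[1+n]≡-1^n (suc n)))) s′≡1)))))

theorem6p1 : (n : ℕ) → n ≥ 2 → (s m : ℤ) → s ≢ + 0 →
    Infinite (IsSolution n s m) ⇔
      (∣ m ∣ ≤ n ∸ 2
       ⊎ (m ≡ + (n ∸ 1) × s ≡ + 1)
       ⊎ (m ≡ - (+ (n ∸ 1)) × s ≡ (- (+ 1)) ^ (n ∸ 1)))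
theorem6p1 (suc zero) (s≤s ()) _ _ _
theorem6p1 (suc (suc n)) _ s m _ = mk⇔
  (λ infinite → decidable-stable (criterion? (2 ℕ.+ n) s m) (infinite ∘ ¬Criterion⇒Finite n s m))
  (Unbounded⇒Infinite ∘ Unbounded-map id (λ _ → ℕP.≤-refl) (Equivalence.from (IsSolution⇔IsSolutionℤ s m _))
                      ∘ Criterion⇒Unbounded n s m)
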